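{- Let $n \geq 1$ and let $\mathcal{F}_n$ be the fan graph. For all $1 \leq k \leq n$, $\kappa_{1,k}(\mathcal{F}_n) = F_{2n-2k+1}$, where $F_m$ is the $m$th Fibonacci number ($F_0=0,F_1=1$).
   Context: The fan graph $\mathcal{F}_n$ has vertices $v_0,\ldots,v_n$ with edges between $v_0$ and $v_i$ for all $i\geq1$, and between $v_i$ and $v_j$ for $i,j\geq 1$ with $|i-j|=1$. $\kappa_{i,j}(G)$ is the number of 2-component spanning forests of $G$ in which one component contains $v_0$ and the other contains both $v_i$ and $v_j$. -}

module Defs where

open import Data.Nat using (ℕ; zero; suc; _+_; _≡ᵇ_)
open import Data.Bool using (Bool; true; false; _∧_; _∨_; not; if_then_else_)
open import Data.List using (List; []; _∷_; _++_; map; filter; length; upTo; zip; concatMap)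
open import Data.Product using (_×_; _,_; proj₁; proj₂)
open import Relation.Binary.PropositionalEquality using (_≡_)
open import Data.Bool.ListAction using (any; all)
open import Data.Bool.Properties using () renaming (_≟_ to _≟B_)

fib : ℕ → ℕ
fib zero = 0
fib (suc zero) = 1
fib (suc (suc m)) = fib m + fib (suc m)

-- A (simple, undirected) graph on vertices 0,…,n is given by its list of edges.
Edge : Set
Edge = ℕ × ℕ

-- Fan graph F_n: vertices v_0,…,v_n (encoded as the naturals 0,…,n);
-- spokes v_0 v_i (1 ≤ i ≤ n) and path edges v_i v_{i+1} (1 ≤ i ≤ n-1).
fanEdges : ℕ → List Edge
fanEdges n = map (λ i → (0 , suc i)) (upTo n) ++ pathEdges n
  where
  pathEdges : ℕ → List Edge
  pathEdges zero = []
  pathEdges (suc zero) = []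
  pathEdges (suc (suc m)) = pathEdges (suc m) ++ ((suc m , suc (suc m)) ∷ [])

-- all subsets of an m-element edge list, as characteristic lists of Booleans
subsets : ℕ → List (List Bool)
subsets zero = [] ∷ []
subsets (suc m) = map (true ∷_) (subsets m) ++ map (false ∷_) (subsets m)

select : List Edge → List Bool → List Edge
select [] _ = []
select (e ∷ es) [] = []
select (e ∷ es) (true ∷ bs) = e ∷ select es bs
select (e ∷ es) (false ∷ bs) = select es bs

elem : ℕ → List ℕ → Bool
elem x = any (x ≡ᵇ_)

step : List Edge → List ℕ → List ℕ
step E R = R ++ concatMap nbrs E
  where
  nbrs : Edge → List ℕ
  nbrs (a , b) = (if elem a R then b ∷ [] else []) ++ (if elem b R then a ∷ [] else [])

iter : ℕ → (List ℕ → List ℕ) → List ℕ → List ℕ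
iter zero f x = x
iter (suc k) f x = iter k f (f x)

-- connected N E u v : v is reachable from u using edges of E in a graph with
-- N vertices (N iterations of the neighbour step suffice: paths have < N edges).
connected : ℕ → List Edge → ℕ → ℕ → Bool
connected N E u v = elem v (iter N (step E) (u ∷ []))

removeAt : List Edge → ℕ → List Edge
removeAt [] _ = []
removeAt (e ∷ es) zero = es
removeAt (e ∷ es) (suc i) = e ∷ removeAt es i

-- acyclic: no edge lies on a cycle, i.e. removing any edge disconnects its endpoints
acyclic : ℕ → List Edge → Bool
acyclic N E = all (λ p → not (connected N (removeAt E (proj₁ p)) (proj₁ (proj₂ p)) (proj₂ (proj₂ p))))
                  (zip (upTo (length E)) E)

-- F is a spanning forest of the graph on vertices 0,…,N-1 with exactly two
-- components, one containing vertex 0 and the other containing vertices i and j.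
isTwoForest : ℕ → ℕ → ℕ → List Edge → Bool
isTwoForest N i j F =
  acyclic N F
  ∧ not (connected N F 0 i)
  ∧ connected N F i j
  ∧ all (λ w → connected N F 0 w ∨ connected N F i w) (upTo N)

-- κ_{i,j}(G) for G given by an edge list on vertices 0,…,N-1: the number of edge
-- subsets forming a 2-component spanning forest separating 0 from {i, j}.
kappa : ℕ → List Edge → ℕ → ℕ → ℕ
kappa N E i j = length (filter (λ b → isTwoForest N i j (select E b) ≟B true)
                               (subsets (length E)))

-- fan graph F_n has n+1 vertices
kappaFan : ℕ → ℕ → ℕ → ℕ
kappaFan n i j = kappa (suc n) (fanEdges n) i j

{-# OPTIONS --safe #-}

-- In a 2-forest of the fan separating v₀ from {v₁, v_k}, the component of v₁ carries no spoke, so it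
-- is a path segment v₁ … v_R with R ≥ k; the remaining vertices v_{R+1} … v_n split into maximal path
-- segments, each attached to v₀ by exactly one spoke.  Reading spoke and path bits vertex by vertex,
-- these edge sets are exactly the words accepted by a small automaton.  Splitting off the first
-- letter, the numbers of accepted completions of m + 1 further vertices are F_{2m+2} (v₀-part, current
-- segment without spoke yet), F_{2m+1} (with spoke) and F_{2m+1} (v₁-part already reaching v_k); the
-- v₁-part must first consume k − 1 path edges, leaving F_{2(n−k)+1}.
--
-- Connectivity as computed by Defs.connected is bounded above by vertex sets closed under the edges
-- (for the fan: intervals of the path whose boundary edges are absent) and below by explicit walks.
-- An edge lies on no cycle as soon as some such interval has it as its only boundary edge.

module Submission where

open import Defs
open import Algebra.Properties.CommutativeSemigroup using (interchange)
open import Data.Bool using (Bool; true; false; _∧_; _∨_; not; if_then_else_; T)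
open import Data.Bool.ListAction using (all)
open import Data.Bool.Properties using (∧-zeroʳ; ∨-zeroʳ) renaming (_≟_ to _≟B_)
open import Data.Empty using (⊥; ⊥-elim)
open import Data.List using (List; []; _∷_; _++_; map; filter; length; upTo; zip; applyUpTo; [_])
open import Data.List.Membership.Propositional using (_∈_; find; lose)
open import Data.List.Membership.Propositional.Properties
  using (∈-++⁺ˡ; ∈-++⁺ʳ; ∈-++⁻; ∈-concatMap⁺; ∈-concatMap⁻; ∈-∃++; ∈-upTo⁺)
open import Data.List.Properties using (++-cancelˡ; length-++)
open import Data.List.Relation.Unary.All using (All; []; _∷_)
import Data.List.Relation.Unary.All as All
open import Data.List.Relation.Unary.AllPairs using (AllPairs; []; _∷_)
import Data.List.Relation.Unary.AllPairs.Properties as AllPairs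
open import Data.List.Relation.Unary.Any using (here; there)
open import Data.Maybe using (Maybe; just; nothing)
open import Data.Nat
open import Data.Nat.Properties
open import Data.Product using (_×_; _,_; proj₁; proj₂; Σ)
open import Data.Sum using (_⊎_; inj₁; inj₂; [_,_]′)
open import Function using (_∘_)
open import Relation.Binary.PropositionalEquality hiding ([_]; J)
open import Relation.Nullary using (¬_; yes; no)

elem≡true⇒∈ : ∀ x R → elem x R ≡ true → x ∈ R
elem≡true⇒∈ x (y ∷ R) h with x ≡ᵇ y in eq
... | true  = here (≡ᵇ⇒≡ x y (subst T (sym eq) _))
... | false = there (elem≡true⇒∈ x R h)

∈⇒elem≡true : ∀ x R → x ∈ R → elem x R ≡ true
∈⇒elem≡true x (y ∷ R) (here refl) with x ≡ᵇ x in eq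
... | true  = refl
... | false = ⊥-elim (subst T eq (≡⇒≡ᵇ x x refl))
∈⇒elem≡true x (y ∷ R) (there h) with x ≡ᵇ y
... | true  = refl
... | false = ∈⇒elem≡true x R h

iter-suc : ∀ t (f : List ℕ → List ℕ) x → iter (suc t) f x ≡ f (iter t f x)
iter-suc zero    f x = refl
iter-suc (suc t) f x = iter-suc t f (f x)

Neighbours : List ℕ → ℕ → ℕ → List ℕ
Neighbours R a b = (if elem a R then b ∷ [] else []) ++ (if elem b R then a ∷ [] else [])

∈-Neighbours⁻ : ∀ R a b x → x ∈ Neighbours R a b → (x ≡ b × a ∈ R) ⊎ (x ≡ a × b ∈ R)
∈-Neighbours⁻ R a b x h with elem a R in ea | elem b R in eb
∈-Neighbours⁻ R a b x (here refl)         | true  | _    = inj₁ (refl , elem≡true⇒∈ a R ea)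
∈-Neighbours⁻ R a b x (there (here refl)) | true  | true = inj₂ (refl , elem≡true⇒∈ b R eb)
∈-Neighbours⁻ R a b x (here refl)         | false | true = inj₂ (refl , elem≡true⇒∈ b R eb)

∈-Neighbours⁺ˡ : ∀ R a b → a ∈ R → b ∈ Neighbours R a b
∈-Neighbours⁺ˡ R a b a∈R rewrite ∈⇒elem≡true a R a∈R = here refl

∈-Neighbours⁺ʳ : ∀ R a b → b ∈ R → a ∈ Neighbours R a b
∈-Neighbours⁺ʳ R a b b∈R rewrite ∈⇒elem≡true b R b∈R with elem a R
... | true  = there (here refl)
... | false = here refl

Closed : (ℕ → Set) → List Edge → Set
Closed S E = ∀ a b → (a , b) ∈ E → (S a → S b) × (S b → S a)

Closed-¬ : ∀ S E → Closed S E → Closed (λ v → ¬ S v) E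
Closed-¬ S E cl a b e∈E = (λ ¬Sa Sb → ¬Sa (proj₂ (cl a b e∈E) Sb)) , (λ ¬Sb Sa → ¬Sb (proj₁ (cl a b e∈E) Sa))

step-⊆-closed : ∀ S E R → Closed S E → (∀ x → x ∈ R → S x) → ∀ x → x ∈ step E R → S x
step-⊆-closed S E R cl R⊆S x x∈ with ∈-++⁻ R x∈
... | inj₁ x∈R = R⊆S x x∈R
... | inj₂ x∈new with find (∈-concatMap⁻ _ {xs = E} x∈new)
... | (a , b) , e∈E , x∈nb with ∈-Neighbours⁻ R a b x x∈nb
... | inj₁ (refl , a∈R) = proj₁ (cl a b e∈E) (R⊆S a a∈R)
... | inj₂ (refl , b∈R) = proj₂ (cl a b e∈E) (R⊆S b b∈R)

iter-step-⊆-closed : ∀ S E t R → Closed S E → (∀ x → x ∈ R → S x) → ∀ x → x ∈ iter t (step E) R → S x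
iter-step-⊆-closed S E zero    R cl R⊆S = R⊆S
iter-step-⊆-closed S E (suc t) R cl R⊆S = iter-step-⊆-closed S E t (step E R) cl (step-⊆-closed S E R cl R⊆S)

connected⇒closed : ∀ S N E u v → Closed S E → S u → connected N E u v ≡ true → S v
connected⇒closed S N E u v cl Su h =
  iter-step-⊆-closed S E N (u ∷ []) cl (λ { x (here refl) → Su }) v (elem≡true⇒∈ v _ h)

closed⇒disconnected : ∀ S N E u v → Closed S E → S u → ¬ S v → connected N E u v ≡ false
closed⇒disconnected S N E u v cl Su ¬Sv with connected N E u v in uv
... | false = refl
... | true  = ⊥-elim (¬Sv (connected⇒closed S N E u v cl Su uv))

Reach : List Edge → ℕ → ℕ → ℕ → Set
Reach E t u v = v ∈ iter t (step E) (u ∷ [])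

reach-refl : ∀ E u → Reach E 0 u u
reach-refl E u = here refl

reach-suc : ∀ E t u v → Reach E t u v → Reach E (suc t) u v
reach-suc E t u v h rewrite iter-suc t (step E) (u ∷ []) = ∈-++⁺ˡ h

reach-along : ∀ E t u a b → (a , b) ∈ E → Reach E t u a → Reach E (suc t) u b
reach-along E t u a b e∈E h rewrite iter-suc t (step E) (u ∷ []) =
  ∈-++⁺ʳ _ (∈-concatMap⁺ _ (lose e∈E (∈-Neighbours⁺ˡ _ a b h)))

reach-against : ∀ E t u a b → (a , b) ∈ E → Reach E t u b → Reach E (suc t) u a
reach-against E t u a b e∈E h rewrite iter-suc t (step E) (u ∷ []) =
  ∈-++⁺ʳ _ (∈-concatMap⁺ _ (lose e∈E (∈-Neighbours⁺ʳ _ a b h)))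

reach-mono : ∀ E t t′ u v → t ≤ t′ → Reach E t u v → Reach E t′ u v
reach-mono E t t′ u v t≤t′ h with m≤n⇒∃[o]m+o≡n t≤t′
... | o , refl = go o
  where
  go : ∀ o → Reach E (t + o) u v
  go zero    rewrite +-identityʳ t = h
  go (suc o) rewrite +-suc t o     = reach-suc E (t + o) u v (go o)

reach⇒connected : ∀ N E t u v → t ≤ N → Reach E t u v → connected N E u v ≡ true
reach⇒connected N E t u v t≤N h = ∈⇒elem≡true v _ (reach-mono E t N u v t≤N h)

PathEdges : List Edge → ℕ → ℕ → Set
PathEdges E a d = ∀ i → i < d → (suc (a + i) , suc (suc (a + i))) ∈ E

reach-along-path : ∀ E t u a d → PathEdges E a d → Reach E t u (suc a) → Reach E (t + d) u (suc (a + d))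
reach-along-path E t u a zero    edges h rewrite +-identityʳ t | +-identityʳ a = h
reach-along-path E t u a (suc d) edges h rewrite +-suc t d | +-suc a d =
  reach-along E (t + d) u (suc (a + d)) (suc (suc (a + d))) (edges d ≤-refl)
    (reach-along-path E t u a d (λ i i<d → edges i (m≤n⇒m≤1+n i<d)) h)

reach-against-path : ∀ E t u a d → PathEdges E a d → Reach E t u (suc (a + d)) → Reach E (t + d) u (suc a)
reach-against-path E t u a zero    edges h rewrite +-identityʳ t | +-identityʳ a = h
reach-against-path E t u a (suc d) edges h rewrite +-suc t d =
  reach-against-path E (suc t) u a d (λ i i<d → edges i (m≤n⇒m≤1+n i<d))
    (reach-against E t u (suc (a + d)) (suc (suc (a + d))) (edges d ≤-refl)
      (subst (λ z → Reach E t u (suc z)) (+-suc a d) h))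

∧-true : ∀ {x y} → x ≡ true → y ≡ true → x ∧ y ≡ true
∧-true refl refl = refl

all-applyUpTo-true : ∀ (f : ℕ → Bool) (g : ℕ → ℕ) m → (∀ i → i < m → f (g i) ≡ true) → all f (applyUpTo g m) ≡ true
all-applyUpTo-true f g zero    h = refl
all-applyUpTo-true f g (suc m) h =
  ∧-true (h 0 (s≤s z≤n)) (all-applyUpTo-true f (g ∘ suc) m (λ i i<m → h (suc i) (s≤s i<m)))

all-false : ∀ (f : ℕ → Bool) L w → w ∈ L → f w ≡ false → all f L ≡ false
all-false f (x ∷ L) w (here refl) fw rewrite fw = refl
all-false f (x ∷ L) w (there w∈) fw rewrite all-false f L w w∈ fw = ∧-zeroʳ (f x)

allSplits : (List Edge → Edge → Bool) → List Edge → Bool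
allSplits Q []       = true
allSplits Q (e ∷ es) = Q es e ∧ allSplits (λ R x → Q (e ∷ R) x) es

all-zip-applyUpTo : ∀ (P : ℕ × Edge → Bool) (f : ℕ → ℕ) m (es : List Edge) →
  all P (zip (applyUpTo f m) es) ≡ all (λ p → P (f (proj₁ p) , proj₂ p)) (zip (upTo m) es)
all-zip-applyUpTo P f zero    es       = refl
all-zip-applyUpTo P f (suc m) []       = refl
all-zip-applyUpTo P f (suc m) (e ∷ es) = cong (P (f 0 , e) ∧_)
  (trans (all-zip-applyUpTo P (λ i → f (suc i)) m es)
         (sym (all-zip-applyUpTo (λ p → P (f (proj₁ p) , proj₂ p)) suc m es)))

all-removeAt≡allSplits : ∀ (Q : List Edge → Edge → Bool) F →
  all (λ p → Q (removeAt F (proj₁ p)) (proj₂ p)) (zip (upTo (length F)) F) ≡ allSplits Q F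
all-removeAt≡allSplits Q []      = refl
all-removeAt≡allSplits Q (e ∷ F) = cong (Q F e ∧_)
  (trans (all-zip-applyUpTo (λ p → Q (removeAt (e ∷ F) (proj₁ p)) (proj₂ p)) suc (length F) F)
         (all-removeAt≡allSplits (λ R x → Q (e ∷ R) x) F))

allSplits-true : ∀ Q F → (∀ pre e post → F ≡ pre ++ e ∷ post → Q (pre ++ post) e ≡ true) → allSplits Q F ≡ true
allSplits-true Q []      h = refl
allSplits-true Q (e ∷ F) h rewrite h [] e F refl =
  allSplits-true (λ R x → Q (e ∷ R) x) F (λ pre x post eq → h (e ∷ pre) x post (cong (e ∷_) eq))

allSplits-false : ∀ Q pre e post → Q (pre ++ post) e ≡ false → allSplits Q (pre ++ e ∷ post) ≡ false
allSplits-false Q []        e post h rewrite h = refl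
allSplits-false Q (y ∷ pre) e post h with Q (pre ++ e ∷ post) y
... | true  = allSplits-false (λ R x → Q (y ∷ R) x) pre e post h
... | false = refl

Distinct : List Edge → Set
Distinct = AllPairs _≢_

∈-split⇒≢ : ∀ pre (e : Edge) post x → Distinct (pre ++ e ∷ post) → x ∈ pre ++ post → x ≢ e
∈-split⇒≢ []        e post x (e∉ ∷ _) x∈ refl = All.lookup e∉ x∈ refl
∈-split⇒≢ (y ∷ pre) e post x (y∉ ∷ _) (here refl) refl = All.lookup y∉ (∈-++⁺ʳ pre (here refl)) refl
∈-split⇒≢ (y ∷ pre) e post x (_ ∷ d) (there x∈) = ∈-split⇒≢ pre e post x d x∈

∈-split⁺ : ∀ pre (e : Edge) post x → x ∈ pre ++ post → x ∈ pre ++ e ∷ post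
∈-split⁺ []        e post x x∈          = there x∈
∈-split⁺ (y ∷ pre) e post x (here refl) = here refl
∈-split⁺ (y ∷ pre) e post x (there x∈)  = there (∈-split⁺ pre e post x x∈)

∈-split⁻ : ∀ pre (e : Edge) post x → x ∈ pre ++ e ∷ post → x ≢ e → x ∈ pre ++ post
∈-split⁻ []        e post x (here refl) x≢e = ⊥-elim (x≢e refl)
∈-split⁻ []        e post x (there x∈)  x≢e = x∈
∈-split⁻ (y ∷ pre) e post x (here refl) x≢e = here refl
∈-split⁻ (y ∷ pre) e post x (there x∈)  x≢e = there (∈-split⁻ pre e post x x∈ x≢e)

nth : List Bool → ℕ → Bool
nth []      _       = false
nth (x ∷ s) zero    = x
nth (x ∷ s) (suc j) = nth s j

nth≡true⇒<length : ∀ s j → nth s j ≡ true → j < length s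
nth≡true⇒<length (x ∷ s) zero    h = s≤s z≤n
nth≡true⇒<length (x ∷ s) (suc j) h = s≤s (nth≡true⇒<length s j h)

spokes : ℕ → ℕ → List Edge
spokes c zero    = []
spokes c (suc n) = (0 , suc c) ∷ spokes (suc c) n

path : ℕ → ℕ → List Edge
path c zero    = []
path c (suc m) = (suc c , suc (suc c)) ∷ path (suc c) m

map-spoke-applyUpTo : ∀ n c (f : ℕ → ℕ) → (∀ i → f i ≡ c + i) →
  map (λ i → (0 , suc i)) (applyUpTo f n) ≡ spokes c n
map-spoke-applyUpTo zero    c f f≗ = refl
map-spoke-applyUpTo (suc n) c f f≗ rewrite f≗ 0 | +-identityʳ c =
  cong ((0 , suc c) ∷_) (map-spoke-applyUpTo n (suc c) (λ i → f (suc i)) (λ i → trans (f≗ (suc i)) (+-suc c i)))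

path-suc : ∀ c m → path c (suc m) ≡ path c m ++ [ (suc (c + m) , suc (suc (c + m))) ]
path-suc c zero    rewrite +-identityʳ c = refl
path-suc c (suc m) rewrite +-suc c m     = cong ((suc c , suc (suc c)) ∷_) (path-suc (suc c) m)

fanEdges≡spokes++path : ∀ n → fanEdges n ≡ spokes 0 n ++ path 0 (n ∸ 1)
fanEdges≡spokes++path zero    = refl
fanEdges≡spokes++path (suc m) =
  trans (go m) (cong (_++ path 0 m) (map-spoke-applyUpTo (suc m) 0 (λ i → i) (λ i → refl)))
  where
  spokeList : ℕ → List Edge
  spokeList n = map (λ i → (0 , suc i)) (upTo n)
  go : ∀ m → fanEdges (suc m) ≡ spokeList (suc m) ++ path 0 m
  go zero    = refl
  go (suc m) = trans
    (cong (λ X → spokeList (suc (suc m)) ++ (X ++ [ (suc m , suc (suc m)) ]))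
          (++-cancelˡ (spokeList (suc m)) _ _ (go m)))
    (cong (spokeList (suc (suc m)) ++_) (sym (path-suc 0 m)))

length-spokes : ∀ c n → length (spokes c n) ≡ n
length-spokes c zero    = refl
length-spokes c (suc n) = cong suc (length-spokes (suc c) n)

length-path : ∀ c n → length (path c n) ≡ n
length-path c zero    = refl
length-path c (suc n) = cong suc (length-path (suc c) n)

length-fanEdges : ∀ n → length (fanEdges n) ≡ n + (n ∸ 1)
length-fanEdges n rewrite fanEdges≡spokes++path n | length-++ (spokes 0 n) {path 0 (n ∸ 1)}
                        | length-spokes 0 n | length-path 0 (n ∸ 1) = refl

select-++ : ∀ (A B : List Edge) s p → length A ≡ length s → select (A ++ B) (s ++ p) ≡ select A s ++ select B p
select-++ []      B []          p h = refl
select-++ (e ∷ A) B (true ∷ s)  p h = cong (e ∷_) (select-++ A B s p (suc-injective h))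
select-++ (e ∷ A) B (false ∷ s) p h = select-++ A B s p (suc-injective h)

∈-select-∷⁻ : ∀ {x} (e : Edge) E b s → x ∈ select (e ∷ E) (b ∷ s) → (b ≡ true × x ≡ e) ⊎ x ∈ select E s
∈-select-∷⁻ e E true  s (here refl) = inj₁ (refl , refl)
∈-select-∷⁻ e E true  s (there x∈)  = inj₂ x∈
∈-select-∷⁻ e E false s x∈          = inj₂ x∈

∈-select-spokes⁻ : ∀ c n s a b → (a , b) ∈ select (spokes c n) s →
  a ≡ 0 × Σ ℕ λ j → b ≡ suc (c + j) × nth s j ≡ true
∈-select-spokes⁻ c (suc n) (x ∷ s) a b e∈ with ∈-select-∷⁻ _ _ x s e∈
... | inj₁ (refl , refl) = refl , 0 , cong suc (sym (+-identityʳ c)) , refl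
... | inj₂ e∈′ with ∈-select-spokes⁻ (suc c) n s a b e∈′
... | a≡0 , j , b≡ , sj = a≡0 , suc j , trans b≡ (cong suc (sym (+-suc c j))) , sj

∈-select-spokes⁺ : ∀ c n s j → nth s j ≡ true → j < n → (0 , suc (c + j)) ∈ select (spokes c n) s
∈-select-spokes⁺ c (suc n) (true ∷ s) zero h j<n rewrite +-identityʳ c = here refl
∈-select-spokes⁺ c (suc n) (x ∷ s) (suc j) h (s≤s j<n) rewrite +-suc c j with x
... | true  = there (∈-select-spokes⁺ (suc c) n s j h j<n)
... | false = ∈-select-spokes⁺ (suc c) n s j h j<n

∈-select-path⁻ : ∀ c n p a b → (a , b) ∈ select (path c n) p →
  Σ ℕ λ j → a ≡ suc (c + j) × b ≡ suc (suc (c + j)) × nth p j ≡ true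
∈-select-path⁻ c (suc n) (x ∷ p) a b e∈ with ∈-select-∷⁻ _ _ x p e∈
... | inj₁ (refl , refl) = 0 , cong suc (sym (+-identityʳ c)) , cong (suc ∘ suc) (sym (+-identityʳ c)) , refl
... | inj₂ e∈′ with ∈-select-path⁻ (suc c) n p a b e∈′
... | j , a≡ , b≡ , pj = suc j , trans a≡ (cong suc (sym (+-suc c j))) , trans b≡ (cong (suc ∘ suc) (sym (+-suc c j))) , pj

∈-select-path⁺ : ∀ c n p j → nth p j ≡ true → j < n → (suc (c + j) , suc (suc (c + j))) ∈ select (path c n) p
∈-select-path⁺ c (suc n) (true ∷ p) zero h j<n rewrite +-identityʳ c = here refl
∈-select-path⁺ c (suc n) (x ∷ p) (suc j) h (s≤s j<n) rewrite +-suc c j with x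
... | true  = there (∈-select-path⁺ (suc c) n p j h j<n)
... | false = ∈-select-path⁺ (suc c) n p j h j<n

All-select : ∀ {P : Edge → Set} E b → All P E → All P (select E b)
All-select []      b           h        = []
All-select (e ∷ E) []          h        = []
All-select (e ∷ E) (true ∷ b)  (Pe ∷ h) = Pe ∷ All-select E b h
All-select (e ∷ E) (false ∷ b) (Pe ∷ h) = All-select E b h

Distinct-select : ∀ E b → Distinct E → Distinct (select E b)
Distinct-select []      b           d        = []
Distinct-select (e ∷ E) []          d        = []
Distinct-select (e ∷ E) (true ∷ b)  (e∉ ∷ d) = All-select E b e∉ ∷ Distinct-select E b d
Distinct-select (e ∷ E) (false ∷ b) (e∉ ∷ d) = Distinct-select E b d

spokes-bound : ∀ c n → All (λ e → proj₁ e ≡ 0 × c < proj₂ e) (spokes c n)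
spokes-bound c zero    = []
spokes-bound c (suc n) = (refl , ≤-refl) ∷ All.map (λ { (e₁ , lt) → e₁ , <⇒≤ lt }) (spokes-bound (suc c) n)

path-bound : ∀ c n → All (λ e → c < proj₁ e) (path c n)
path-bound c zero    = []
path-bound c (suc n) = ≤-refl ∷ All.map <⇒≤ (path-bound (suc c) n)

spokes-distinct : ∀ c n → Distinct (spokes c n)
spokes-distinct c zero    = []
spokes-distinct c (suc n) =
  All.map (λ { (_ , lt) eq → <-irrefl (cong proj₂ eq) lt }) (spokes-bound (suc c) n) ∷ spokes-distinct (suc c) n

path-distinct : ∀ c n → Distinct (path c n)
path-distinct c zero    = []
path-distinct c (suc n) = All.map (λ lt eq → <-irrefl (cong proj₁ eq) lt) (path-bound (suc c) n) ∷ path-distinct (suc c) n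

fanEdges-distinct : ∀ n → Distinct (fanEdges n)
fanEdges-distinct n = subst Distinct (sym (fanEdges≡spokes++path n))
  (AllPairs.++⁺ (spokes-distinct 0 n) (path-distinct 0 (n ∸ 1))
    (All.map (λ { (e₁ , _) → All.map (λ lt eq → <-irrefl (trans (sym e₁) (cong proj₁ eq)) lt) (path-bound 0 (n ∸ 1)) })
             (spokes-bound 0 n)))

-- The automaton reads vertex v_{i+1} as the spoke bit σ i and the bit π i of the path edge to v_{i+2}.
-- In state inOne d the current vertex belongs to the component of v₁, which must still grow by d
-- vertices to reach v_k; in state inZero h it belongs to the component of v₀, and h records whether
-- its maximal path segment already has its (unique) spoke.
data State : Set where
  inOne  : ℕ → State
  inZero : Bool → State

next : State → Bool → Bool → Maybe State
next (inOne d)       true  _     = nothing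
next (inOne d)       false true  = just (inOne (pred d))
next (inOne zero)    false false = just (inZero false)
next (inOne (suc d)) false false = nothing
next (inZero true)   true  _     = nothing
next (inZero true)   false true  = just (inZero true)
next (inZero true)   false false = just (inZero false)
next (inZero false)  true  true  = just (inZero true)
next (inZero false)  true  false = just (inZero false)
next (inZero false)  false true  = just (inZero false)
next (inZero false)  false false = nothing

final : State → Bool → Bool
final (inOne zero)   false = true
final (inOne _)      _     = false
final (inZero true)  false = true
final (inZero false) true  = true
final (inZero _)     _     = false

mutual
  run : (ℕ → Bool) → (ℕ → Bool) → ℕ → State → Bool
  run σ π zero          q = false
  run σ π (suc zero)    q = final q (σ 0)
  run σ π (suc (suc r)) q = runMaybe (σ ∘ suc) (π ∘ suc) (suc r) (next q (σ 0) (π 0))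

  runMaybe : (ℕ → Bool) → (ℕ → Bool) → ℕ → Maybe State → Bool
  runMaybe σ π r nothing  = false
  runMaybe σ π r (just q) = run σ π r q

mutual
  run-cong : ∀ r q {σ σ′ π π′} → (∀ i → σ i ≡ σ′ i) → (∀ i → π i ≡ π′ i) → run σ π r q ≡ run σ′ π′ r q
  run-cong zero          q σ≗ π≗ = refl
  run-cong (suc zero)    q σ≗ π≗ = cong (final q) (σ≗ 0)
  run-cong (suc (suc r)) q {σ} {σ′} {π} {π′} σ≗ π≗ =
    trans (cong₂ (λ x y → runMaybe (σ ∘ suc) (π ∘ suc) (suc r) (next q x y)) (σ≗ 0) (π≗ 0))
          (runMaybe-cong (suc r) (next q (σ′ 0) (π′ 0)) (σ≗ ∘ suc) (π≗ ∘ suc))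

  runMaybe-cong : ∀ r m {σ σ′ π π′} → (∀ i → σ i ≡ σ′ i) → (∀ i → π i ≡ π′ i) → runMaybe σ π r m ≡ runMaybe σ′ π′ r m
  runMaybe-cong r nothing  σ≗ π≗ = refl
  runMaybe-cong r (just q) σ≗ π≗ = run-cong r q σ≗ π≗

m<n∸1⇒1+m<n : ∀ {m} n → m < n ∸ 1 → suc m < n
m<n∸1⇒1+m<n (suc n) m<n = s≤s m<n

bit-conflict : ∀ {x : Bool} {A : Set} → x ≡ true → x ≡ false → A
bit-conflict refl ()

-- Bit j of s selects the spoke v₀v_{j+1}, bit j of p the path edge v_{j+1}v_{j+2}.
module FanSelection (n : ℕ) (s p : List Bool) (|s|≡n : length s ≡ n) (|p|≡n∸1 : length p ≡ n ∸ 1)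
                    (k : ℕ) (1≤k : 1 ≤ k) (k≤n : k ≤ n) where

  N : ℕ
  N = suc n

  F : List Edge
  F = select (fanEdges n) (s ++ p)

  F≡ : F ≡ select (spokes 0 n) s ++ select (path 0 (n ∸ 1)) p
  F≡ = trans (cong (λ E → select E (s ++ p)) (fanEdges≡spokes++path n))
             (select-++ (spokes 0 n) (path 0 (n ∸ 1)) s p (trans (length-spokes 0 n) (sym |s|≡n)))

  spoke<n : ∀ j → nth s j ≡ true → j < n
  spoke<n j sj = subst (j <_) |s|≡n (nth≡true⇒<length s j sj)

  path<n : ∀ j → nth p j ≡ true → suc j < n
  path<n j pj = m<n∸1⇒1+m<n n (subst (j <_) |p|≡n∸1 (nth≡true⇒<length p j pj))

  ∈F⁻ : ∀ a b → (a , b) ∈ F →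
    (a ≡ 0 × Σ ℕ λ j → b ≡ suc j × nth s j ≡ true) ⊎ (Σ ℕ λ j → a ≡ suc j × b ≡ suc (suc j) × nth p j ≡ true)
  ∈F⁻ a b e∈ with ∈-++⁻ (select (spokes 0 n) s) (subst ((a , b) ∈_) F≡ e∈)
  ... | inj₁ e∈spokes = inj₁ (∈-select-spokes⁻ 0 n s a b e∈spokes)
  ... | inj₂ e∈path   = inj₂ (∈-select-path⁻ 0 (n ∸ 1) p a b e∈path)

  spoke∈F : ∀ j → nth s j ≡ true → (0 , suc j) ∈ F
  spoke∈F j sj = subst ((0 , suc j) ∈_) (sym F≡) (∈-++⁺ˡ (∈-select-spokes⁺ 0 n s j sj (spoke<n j sj)))

  path∈F : ∀ j → nth p j ≡ true → (suc j , suc (suc j)) ∈ F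
  path∈F j pj = subst ((suc j , suc (suc j)) ∈_) (sym F≡)
    (∈-++⁺ʳ (select (spokes 0 n) s) (∈-select-path⁺ 0 (n ∸ 1) p j pj (subst (j <_) |p|≡n∸1 (nth≡true⇒<length p j pj))))

  F-distinct : Distinct F
  F-distinct = Distinct-select (fanEdges n) (s ++ p) (fanEdges-distinct n)

  edge≤n : ∀ a b → (a , b) ∈ F → b ≤ n
  edge≤n a b e∈ with ∈F⁻ a b e∈
  ... | inj₁ (refl , j , refl , sj) = spoke<n j sj
  ... | inj₂ (j , refl , refl , pj) = path<n j pj

  lastPathBit : ∀ c → suc c ≡ n → nth p c ≡ false
  lastPathBit c 1+c≡n with nth p c in pc
  ... | false = refl
  ... | true  = ⊥-elim (<-irrefl 1+c≡n (path<n c pc))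

  Between : ℕ → ℕ → ℕ → Set
  Between l R v = l ≤ v × v ≤ R

  -- Every edge of F with exactly one endpoint in the vertex interval [l, R] satisfies X.
  record CutBy (X : Edge → Set) (l R : ℕ) : Set where
    field
      1≤l   : 1 ≤ l
      spoke : ∀ j → l ≤ suc j → suc j ≤ R → nth s j ≡ true → X (0 , suc j)
      left  : ∀ j → suc (suc j) ≡ l → nth p j ≡ true → X (suc j , l)
      right : ∀ j → suc j ≡ R → nth p j ≡ true → X (R , suc R)

  Between-closed : ∀ X l R → CutBy X l R → ∀ a b → (a , b) ∈ F → ¬ X (a , b) →
    (Between l R a → Between l R b) × (Between l R b → Between l R a)
  Between-closed X l R cut a b e∈ ¬X with ∈F⁻ a b e∈
  ... | inj₁ (refl , j , refl , sj) =
        (λ { (l≤0 , _) → ⊥-elim (<-irrefl refl (≤-trans (CutBy.1≤l cut) l≤0)) }) ,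
        (λ { (l≤b , b≤R) → ⊥-elim (¬X (CutBy.spoke cut j l≤b b≤R sj)) })
  ... | inj₂ (j , refl , refl , pj) = forward , backward
    where
    forward : Between l R (suc j) → Between l R (suc (suc j))
    forward (l≤a , a≤R) with m≤n⇒m<n∨m≡n a≤R
    ... | inj₁ a<R = m≤n⇒m≤1+n l≤a , a<R
    ... | inj₂ a≡R = ⊥-elim (¬X (subst (λ z → X (z , suc z)) (sym a≡R) (CutBy.right cut j a≡R pj)))
    backward : Between l R (suc (suc j)) → Between l R (suc j)
    backward (l≤b , b≤R) with m≤n⇒m<n∨m≡n l≤b
    ... | inj₁ l<b = ≤-pred l<b , ≤-trans (n≤1+n _) b≤R
    ... | inj₂ l≡b = ⊥-elim (¬X (subst (λ z → X (suc j , z)) l≡b (CutBy.left cut j (sym l≡b) pj)))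

  Between-closed-F : ∀ l R → CutBy (λ _ → ⊥) l R → Closed (Between l R) F
  Between-closed-F l R cut a b e∈ = Between-closed (λ _ → ⊥) l R cut a b e∈ (λ ())

  Between-closed-split : ∀ l R e pre post → F ≡ pre ++ e ∷ post → CutBy (_≡ e) l R → Closed (Between l R) (pre ++ post)
  Between-closed-split l R e pre post F≡split cut a b e∈ =
    Between-closed (_≡ e) l R cut a b (subst ((a , b) ∈_) (sym F≡split) (∈-split⁺ pre e post (a , b) e∈))
      (∈-split⇒≢ pre e post (a , b) (subst Distinct F≡split F-distinct) e∈)

  -- A witness that (a , b) is a bridge of F: an interval whose only boundary edge is (a , b).
  Separating : ℕ → ℕ → Set
  Separating a b = Σ ℕ λ l → Σ ℕ λ R → CutBy (_≡ (a , b)) l R ×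
    ((Between l R a × ¬ Between l R b) ⊎ (¬ Between l R a × Between l R b))

  separating⇒disconnected : ∀ a b → Separating a b → ∀ pre post → F ≡ pre ++ (a , b) ∷ post →
    connected N (pre ++ post) a b ≡ false
  separating⇒disconnected a b (l , R , cut , inj₁ (a∈ , b∉)) pre post F≡split =
    closed⇒disconnected _ N _ a b (Between-closed-split l R (a , b) pre post F≡split cut) a∈ b∉
  separating⇒disconnected a b (l , R , cut , inj₂ (a∉ , b∈)) pre post F≡split =
    closed⇒disconnected _ N _ a b (Closed-¬ _ _ (Between-closed-split l R (a , b) pre post F≡split cut))
      a∉ (λ b∉ → b∉ b∈)

  Bits : List Bool → Bool → ℕ → ℕ → Set
  Bits q x lo hi = ∀ i → lo ≤ i → i < hi → nth q i ≡ x

  Bits-empty : ∀ q x c → Bits q x c c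
  Bits-empty q x c i c≤i i<c = ⊥-elim (≤⇒≯ c≤i i<c)

  Bits-snoc : ∀ q x lo c → Bits q x lo c → nth q c ≡ x → Bits q x lo (suc c)
  Bits-snoc q x lo c bits qc i lo≤i i<1+c with m<1+n⇒m<n∨m≡n i<1+c
  ... | inj₁ i<c  = bits i lo≤i i<c
  ... | inj₂ refl = qc

  Bits-⊆ : ∀ q x {lo hi lo′ hi′} → lo ≤ lo′ → hi′ ≤ hi → Bits q x lo hi → Bits q x lo′ hi′
  Bits-⊆ q x lo≤lo′ hi′≤hi bits i lo′≤i i<hi′ = bits i (≤-trans lo≤lo′ lo′≤i) (<-≤-trans i<hi′ hi′≤hi)

  record SoleSpoke (lo hi : ℕ) : Set where
    field
      J       : ℕ
      lo≤J    : lo ≤ J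
      J<hi    : J < hi
      spokeJ  : nth s J ≡ true
      noOther : ∀ i → lo ≤ i → i < hi → i ≢ J → nth s i ≡ false

  SoleSpoke-snoc : ∀ lo c → SoleSpoke lo c → nth s c ≡ false → SoleSpoke lo (suc c)
  SoleSpoke-snoc lo c sole sc = record
    { J = J ; lo≤J = lo≤J ; J<hi = m<n⇒m<1+n J<hi ; spokeJ = spokeJ
    ; noOther = λ i lo≤i i<1+c i≢J →
        [ (λ i<c → noOther i lo≤i i<c i≢J) , (λ { refl → sc }) ]′ (m<1+n⇒m<n∨m≡n i<1+c) }
    where open SoleSpoke sole

  SoleSpoke-new : ∀ lo c → lo ≤ c → Bits s false lo c → nth s c ≡ true → SoleSpoke lo (suc c)
  SoleSpoke-new lo c lo≤c none sc = record
    { J = c ; lo≤J = lo≤c ; J<hi = ≤-refl ; spokeJ = sc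
    ; noOther = λ i lo≤i i<1+c i≢c → [ (λ i<c → none i lo≤i i<c) , (λ i≡c → ⊥-elim (i≢c i≡c)) ]′ (m<1+n⇒m<n∨m≡n i<1+c) }

  Seen : Bool → ℕ → ℕ → Set
  Seen false lo hi = Bits s false lo hi
  Seen true  lo hi = SoleSpoke lo hi

  linked⇒PathEdges : ∀ a d → Bits p true a (a + d) → PathEdges F a d
  linked⇒PathEdges a d linked i i<d = path∈F (a + i) (linked (a + i) (m≤m+n a i) (+-monoʳ-< a i<d))

  connected₀-after-spoke : ∀ J d → nth s J ≡ true → Bits p true J (J + d) → J + d < n →
    connected N F 0 (suc (J + d)) ≡ true
  connected₀-after-spoke J d sJ linked J+d<n =
    reach⇒connected N F (1 + d) 0 (suc (J + d)) (s≤s (≤-trans (m≤n+m d J) (<⇒≤ J+d<n)))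
      (reach-along-path F 1 0 J d (linked⇒PathEdges J d linked)
        (reach-along F 0 0 0 (suc J) (spoke∈F J sJ) (reach-refl F 0)))

  connected₀-before-spoke : ∀ w d → nth s (w + d) ≡ true → Bits p true w (w + d) → w + d < n →
    connected N F 0 (suc w) ≡ true
  connected₀-before-spoke w d sJ linked w+d<n =
    reach⇒connected N F (1 + d) 0 (suc w) (s≤s (≤-trans (m≤n+m d w) (<⇒≤ w+d<n)))
      (reach-against-path F 1 0 w d (linked⇒PathEdges w d linked)
        (reach-along F 0 0 0 (suc (w + d)) (spoke∈F (w + d) sJ) (reach-refl F 0)))

  ZeroPart : ℕ → ℕ → Set
  ZeroPart l R = (∀ a b → (a , b) ∈ F → l ≤ b → b ≤ R → Separating a b) ×
                 (∀ w → l ≤ w → w ≤ R → connected N F 0 w ≡ true)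

  ZeroPart-glue : ∀ l R T → ZeroPart l R → ZeroPart (suc R) T → ZeroPart l T
  ZeroPart-glue l R T (sep₁ , conn₁) (sep₂ , conn₂) =
    (λ a b e∈ l≤b b≤T → [ sep₁ a b e∈ l≤b , (λ R<b → sep₂ a b e∈ R<b b≤T) ]′ (≤-<-connex b R)) ,
    (λ w l≤w w≤T → [ conn₁ w l≤w , (λ R<w → conn₂ w R<w w≤T) ]′ (≤-<-connex w R))

  module ZeroSegment (c₁ c : ℕ) (sole : SoleSpoke (suc c₁) (suc c)) (linked : Bits p true (suc c₁) c)
                     (gapˡ : nth p c₁ ≡ false) (gapʳ : nth p c ≡ false) (c<n : c < n) where
    open SoleSpoke sole

    reached : ∀ w → suc (suc c₁) ≤ w → w ≤ suc c → connected N F 0 w ≡ true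
    reached (suc w) (s≤s c₁<w) (s≤s w≤c) with ≤-total J w
    ... | inj₁ J≤w with m≤n⇒∃[o]m+o≡n J≤w
    ...   | d , refl = connected₀-after-spoke J d spokeJ (Bits-⊆ p true lo≤J w≤c linked) (≤-<-trans w≤c c<n)
    reached (suc w) (s≤s c₁<w) (s≤s w≤c) | inj₂ w≤J with m≤n⇒∃[o]m+o≡n w≤J
    ...   | d , refl = connected₀-before-spoke w d spokeJ (Bits-⊆ p true c₁<w (≤-pred J<hi) linked) (≤-<-trans (≤-pred J<hi) c<n)

    sole-spoke : ∀ j → suc c₁ ≤ j → j ≤ c → nth s j ≡ true → j ≡ J
    sole-spoke j c₁<j j≤c sj with j ≟ J
    ... | yes j≡J = j≡J
    ... | no  j≢J = bit-conflict sj (noOther j c₁<j (s≤s j≤c) j≢J)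

    not-gapˡ : ∀ j → nth p j ≡ true → suc (suc j) ≡ suc (suc c₁) → ⊥
    not-gapˡ j pj refl = bit-conflict pj gapˡ

    not-gapʳ : ∀ j → nth p j ≡ true → suc j ≡ suc c → ⊥
    not-gapʳ j pj refl = bit-conflict pj gapʳ

    -- The spoke is cut off by the whole segment, a path edge by the part of the segment beyond it.
    separating-spoke : Separating 0 (suc J)
    separating-spoke = suc (suc c₁) , suc c ,
      record { 1≤l = s≤s z≤n
             ; spoke = λ j l≤ ≤R sj → cong (λ z → (0 , suc z)) (sole-spoke j (≤-pred l≤) (≤-pred ≤R) sj)
             ; left = λ j eq pj → ⊥-elim (not-gapˡ j pj eq)
             ; right = λ j eq pj → ⊥-elim (not-gapʳ j pj eq) } ,
      inj₂ ((λ { (() , _) }) , (s≤s lo≤J , s≤s (≤-pred J<hi)))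

    separating-right : ∀ j → J ≤ j → suc (suc j) ≤ suc c → Separating (suc j) (suc (suc j))
    separating-right j J≤j b≤R = suc (suc j) , suc c ,
      record { 1≤l = s≤s z≤n
             ; spoke = λ j′ l≤ ≤R sj′ →
                 ⊥-elim (<-irrefl (sym (sole-spoke j′ (≤-trans lo≤J (≤-trans J≤j (≤-trans (n≤1+n j) (≤-pred l≤)))) (≤-pred ≤R) sj′))
                                  (≤-trans (s≤s J≤j) (≤-pred l≤)))
             ; left = λ j′ eq pj′ → cong (λ z → (suc z , suc (suc j))) (suc-injective (suc-injective eq))
             ; right = λ j′ eq pj′ → ⊥-elim (not-gapʳ j′ pj′ eq) } ,
      inj₂ ((λ { (l≤a , _) → <-irrefl refl l≤a }) , (≤-refl , b≤R))

    separating-left : ∀ j → j < J → suc (suc c₁) ≤ suc j → Separating (suc j) (suc (suc j))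
    separating-left j j<J l≤a = suc (suc c₁) , suc j ,
      record { 1≤l = s≤s z≤n
             ; spoke = λ j′ l≤ ≤R sj′ →
                 ⊥-elim (<-irrefl (sole-spoke j′ (≤-pred l≤) (≤-trans (≤-pred ≤R) (<⇒≤ (<-≤-trans j<J (≤-pred J<hi)))) sj′)
                                  (≤-<-trans (≤-pred ≤R) j<J))
             ; left = λ j′ eq pj′ → ⊥-elim (not-gapˡ j′ pj′ eq)
             ; right = λ j′ eq pj′ → refl } ,
      inj₁ ((l≤a , ≤-refl) , (λ { (_ , b≤a) → <-irrefl refl b≤a }))

    separating : ∀ a b → (a , b) ∈ F → suc (suc c₁) ≤ b → b ≤ suc c → Separating a b
    separating a b e∈ l≤b b≤R with ∈F⁻ a b e∈
    ... | inj₁ (refl , j , refl , sj) with sole-spoke j (≤-pred l≤b) (≤-pred b≤R) sj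
    ...   | refl = separating-spoke
    separating a b e∈ l≤b b≤R | inj₂ (j , refl , refl , pj) with J ≤? j
    ... | yes J≤j = separating-right j J≤j b≤R
    ... | no  J≰j with m≤n⇒m<n∨m≡n l≤b
    ...   | inj₁ l<b = separating-left j (≰⇒> J≰j) (≤-pred l<b)
    ...   | inj₂ l≡b = ⊥-elim (not-gapˡ j pj (sym l≡b))

  -- A maximal path segment v_{c₁+2} … v_{c+1} carrying exactly one spoke is a tree hanging from v₀.
  zeroSegment : ∀ c₁ c → SoleSpoke (suc c₁) (suc c) → Bits p true (suc c₁) c →
    nth p c₁ ≡ false → nth p c ≡ false → c < n → ZeroPart (suc (suc c₁)) (suc c)
  zeroSegment c₁ c sole linked gapˡ gapʳ c<n = separating , reached
    where open ZeroSegment c₁ c sole linked gapˡ gapʳ c<n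

  OnePart : ℕ → Set
  OnePart R = (∀ a b → (a , b) ∈ F → b ≤ R → Separating a b) ×
              (∀ w → 1 ≤ w → w ≤ R → connected N F 1 w ≡ true) ×
              connected N F 0 1 ≡ false

  oneSegment-cut : ∀ c → Bits s false 0 (suc c) → nth p c ≡ false → CutBy (λ _ → ⊥) 1 (suc c)
  oneSegment-cut c none gapʳ = record
    { 1≤l = s≤s z≤n
    ; spoke = λ j _ ≤R sj → bit-conflict sj (none j z≤n ≤R)
    ; left = λ j eq _ → ⊥-elim (0≢1+n (sym (suc-injective eq)))
    ; right = λ { j refl pj → bit-conflict pj gapʳ } }

  -- The segment v₁ … v_{c+1}, joined by path edges and free of spokes, is the component of v₁.
  oneSegment : ∀ c → Bits s false 0 (suc c) → Bits p true 0 c → nth p c ≡ false → c < n → OnePart (suc c)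
  oneSegment c none linked gapʳ c<n = separating , reached ,
    closed⇒disconnected _ N F 0 1 (Closed-¬ _ F (Between-closed-F 1 (suc c) (oneSegment-cut c none gapʳ)))
      (λ { (() , _) }) (λ ¬1∈ → ¬1∈ (s≤s z≤n , s≤s z≤n))
    where
    reached : ∀ w → 1 ≤ w → w ≤ suc c → connected N F 1 w ≡ true
    reached (suc w) _ (s≤s w≤c) = reach⇒connected N F w 1 (suc w) (≤-trans w≤c (≤-trans (<⇒≤ c<n) (n≤1+n n)))
      (reach-along-path F 0 1 0 w (linked⇒PathEdges 0 w (Bits-⊆ p true z≤n w≤c linked)) (reach-refl F 1))
    separating : ∀ a b → (a , b) ∈ F → b ≤ suc c → Separating a b
    separating a b e∈ b≤R with ∈F⁻ a b e∈
    ... | inj₁ (refl , j , refl , sj) = bit-conflict sj (none j z≤n b≤R)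
    ... | inj₂ (j , refl , refl , pj) = 1 , suc j ,
          record { 1≤l = s≤s z≤n
                 ; spoke = λ j′ _ ≤R sj′ → bit-conflict sj′ (none j′ z≤n (≤-trans ≤R (<⇒≤ b≤R)))
                 ; left = λ j′ eq _ → ⊥-elim (0≢1+n (sym (suc-injective eq)))
                 ; right = λ _ _ _ → refl } ,
          inj₁ ((s≤s z≤n , ≤-refl) , (λ { (_ , b≤a) → <-irrefl refl b≤a }))

  remaining-step : ∀ r c → suc (suc r) + c ≡ n → suc r + suc c ≡ n
  remaining-step r c eq = trans (+-suc (suc r) c) eq

  remaining⇒< : ∀ r c → suc r + c ≡ n → c < n
  remaining⇒< r c eq = subst (c <_) eq (s≤s (m≤n+m c r))

  shifted : List Bool → ℕ → ℕ → Bool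
  shifted q c i = nth q (i + c)

  run-shift : ∀ c r q → run (shifted s c) (shifted p c) (suc (suc r)) q ≡
                        runMaybe (shifted s (suc c)) (shifted p (suc c)) (suc r) (next q (nth s c) (nth p c))
  run-shift c r q = runMaybe-cong (suc r) (next q (nth s c) (nth p c))
    (λ i → cong (nth s) (sym (+-suc i c))) (λ i → cong (nth p) (sym (+-suc i c)))

  -- Position c lies in a segment of the v₀-part that starts at v_{c₁+2}, after the missing path edge c₁.
  record InZero (c₁ c : ℕ) (h : Bool) : Set where
    field
      c₁<c   : c₁ < c
      gap    : nth p c₁ ≡ false
      linked : Bits p true (suc c₁) c
      seen   : Seen h (suc c₁) c

  InZero-start : ∀ c → nth p c ≡ false → InZero c (suc c) false
  InZero-start c gap = record
    { c₁<c = ≤-refl ; gap = gap ; linked = Bits-empty p true (suc c) ; seen = Bits-empty s false (suc c) }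

  InZero-extend : ∀ {c₁ c h} h′ → InZero c₁ c h → nth p c ≡ true → Seen h′ (suc c₁) (suc c) → InZero c₁ (suc c) h′
  InZero-extend {c₁} {c} h′ inv pc seen′ = record
    { c₁<c = m<n⇒m<1+n c₁<c ; gap = gap ; linked = Bits-snoc p true (suc c₁) c linked pc ; seen = seen′ }
    where open InZero inv

  accept-inZero⇒ZeroPart : ∀ r c c₁ h → suc r + c ≡ n → InZero c₁ c h →
    run (shifted s c) (shifted p c) (suc r) (inZero h) ≡ true → ZeroPart (suc (suc c₁)) n
  accept-inZero⇒ZeroPart zero c c₁ h 1+c≡n inv acc = go h (nth s c) refl seen acc
    where
    open InZero inv
    segment : SoleSpoke (suc c₁) (suc c) → ZeroPart (suc (suc c₁)) n
    segment sole = subst (ZeroPart _) 1+c≡n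
      (zeroSegment c₁ c sole linked gap (lastPathBit c 1+c≡n) (remaining⇒< 0 c 1+c≡n))
    go : ∀ h x → nth s c ≡ x → Seen h (suc c₁) c → final (inZero h) x ≡ true → ZeroPart (suc (suc c₁)) n
    go true  false sc sole _ = segment (SoleSpoke-snoc (suc c₁) c sole sc)
    go false true  sc none _ = segment (SoleSpoke-new (suc c₁) c c₁<c none sc)
  accept-inZero⇒ZeroPart (suc r) c c₁ h r+c≡n inv acc =
    go h (nth s c) (nth p c) refl refl seen (trans (sym (run-shift c r (inZero h))) acc)
    where
    open InZero inv
    c<n : c < n
    c<n = remaining⇒< (suc r) c r+c≡n
    continue : ∀ h′ → nth p c ≡ true → Seen h′ (suc c₁) (suc c) →
      runMaybe (shifted s (suc c)) (shifted p (suc c)) (suc r) (just (inZero h′)) ≡ true → ZeroPart (suc (suc c₁)) n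
    continue h′ pc seen′ = accept-inZero⇒ZeroPart r (suc c) c₁ h′ (remaining-step r c r+c≡n) (InZero-extend h′ inv pc seen′)
    close : SoleSpoke (suc c₁) (suc c) → nth p c ≡ false →
      runMaybe (shifted s (suc c)) (shifted p (suc c)) (suc r) (just (inZero false)) ≡ true → ZeroPart (suc (suc c₁)) n
    close sole pc acc = ZeroPart-glue _ (suc c) n (zeroSegment c₁ c sole linked gap pc c<n)
      (accept-inZero⇒ZeroPart r (suc c) c false (remaining-step r c r+c≡n) (InZero-start c pc) acc)
    go : ∀ h x y → nth s c ≡ x → nth p c ≡ y → Seen h (suc c₁) c →
      runMaybe (shifted s (suc c)) (shifted p (suc c)) (suc r) (next (inZero h) x y) ≡ true → ZeroPart (suc (suc c₁)) n
    go true  false true  sc pc sole = continue true pc (SoleSpoke-snoc (suc c₁) c sole sc)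
    go true  false false sc pc sole = close (SoleSpoke-snoc (suc c₁) c sole sc) pc
    go false true  true  sc pc none = continue true pc (SoleSpoke-new (suc c₁) c c₁<c none sc)
    go false true  false sc pc none = close (SoleSpoke-new (suc c₁) c c₁<c none sc) pc
    go false false true  sc pc none = continue false pc (Bits-snoc s false (suc c₁) c none sc)
    go true  true  _     _  _  _    ()
    go false false false _  _  _    ()

  record TwoForest : Set where
    field
      separating : ∀ a b → (a , b) ∈ F → Separating a b
      covered    : ∀ w → 1 ≤ w → w ≤ n → connected N F 0 w ≡ true ⊎ connected N F 1 w ≡ true
      0≁1        : connected N F 0 1 ≡ false
      1∼k        : connected N F 1 k ≡ true

  accept-inOne⇒TwoForest : ∀ r c d → suc r + c ≡ n → Bits s false 0 c → Bits p true 0 c → d ≡ k ∸ suc c →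
    run (shifted s c) (shifted p c) (suc r) (inOne d) ≡ true → TwoForest
  accept-inOne⇒TwoForest zero c d 1+c≡n none linked d≡ acc = go d (nth s c) refl d≡ acc
    where
    go : ∀ d x → nth s c ≡ x → d ≡ k ∸ suc c → final (inOne d) x ≡ true → TwoForest
    go zero false sc 0≡ _ with oneSegment c (Bits-snoc s false 0 c none sc) linked (lastPathBit c 1+c≡n) (remaining⇒< 0 c 1+c≡n)
    ... | separating , reached , 0≁1 = record
      { separating = λ a b e∈ → separating a b e∈ (subst (b ≤_) (sym 1+c≡n) (edge≤n a b e∈))
      ; covered = λ w 1≤w w≤n → inj₂ (reached w 1≤w (subst (w ≤_) (sym 1+c≡n) w≤n))
      ; 0≁1 = 0≁1
      ; 1∼k = reached k 1≤k (m∸n≡0⇒m≤n (sym 0≡)) }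
  accept-inOne⇒TwoForest (suc r) c d r+c≡n none linked d≡ acc =
    go d (nth s c) (nth p c) refl refl d≡ (trans (sym (run-shift c r (inOne d))) acc)
    where
    c<n : c < n
    c<n = remaining⇒< (suc r) c r+c≡n
    go : ∀ d x y → nth s c ≡ x → nth p c ≡ y → d ≡ k ∸ suc c →
      runMaybe (shifted s (suc c)) (shifted p (suc c)) (suc r) (next (inOne d) x y) ≡ true → TwoForest
    go d false true sc pc d≡ = accept-inOne⇒TwoForest r (suc c) (pred d) (remaining-step r c r+c≡n)
      (Bits-snoc s false 0 c none sc) (Bits-snoc p true 0 c linked pc) (trans (cong pred d≡) (pred[m∸n]≡m∸[1+n] k (suc c)))
    go zero false false sc pc 0≡ acc
      with oneSegment c (Bits-snoc s false 0 c none sc) linked pc c<n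
         | accept-inZero⇒ZeroPart r (suc c) c false (remaining-step r c r+c≡n) (InZero-start c pc) acc
    ... | separating₁ , reached₁ , 0≁1 | separating₀ , reached₀ = record
      { separating = λ a b e∈ → [ separating₁ a b e∈ , (λ c+1<b → separating₀ a b e∈ c+1<b (edge≤n a b e∈)) ]′ (≤-<-connex b (suc c))
      ; covered = λ w 1≤w w≤n → [ inj₂ ∘ reached₁ w 1≤w , (λ c+1<w → inj₁ (reached₀ w c+1<w w≤n)) ]′ (≤-<-connex w (suc c))
      ; 0≁1 = 0≁1
      ; 1∼k = reached₁ k 1≤k (m∸n≡0⇒m≤n (sym 0≡)) }
    go d       true  _     _ _ _ ()
    go (suc d) false false _ _ _ ()

  data Failure : Set where
    0∼1      : connected N F 0 1 ≡ true → Failure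
    1≁k      : connected N F 1 k ≡ false → Failure
    cycle    : ∀ a b → (a , b) ∈ F → (∀ pre post → F ≡ pre ++ (a , b) ∷ post → connected N (pre ++ post) a b ≡ true) → Failure
    stranded : ∀ w → w ≤ n → connected N F 0 w ≡ false → connected N F 1 w ≡ false → Failure

  spoke-in-onePart : ∀ c → Bits p true 0 c → nth s c ≡ true → c < n → Failure
  spoke-in-onePart c linked sc c<n = 0∼1 (reach⇒connected N F (1 + c) 0 1 (s≤s (<⇒≤ c<n))
    (reach-against-path F 1 0 0 c (linked⇒PathEdges 0 c linked) (reach-along F 0 0 0 (suc c) (spoke∈F c sc) (reach-refl F 0))))

  onePart-too-short : ∀ c → Bits s false 0 (suc c) → nth p c ≡ false → suc c < k → Failure
  onePart-too-short c none gapʳ c+1<k = 1≁k (closed⇒disconnected _ N F 1 k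
    (Between-closed-F 1 (suc c) (oneSegment-cut c none gapʳ)) (s≤s z≤n , s≤s z≤n) (λ { (_ , k≤c+1) → ≤⇒≯ k≤c+1 c+1<k }))

  two-spokes-in-segment : ∀ J c → J < c → nth s J ≡ true → nth s c ≡ true → Bits p true J c → c < n → Failure
  two-spokes-in-segment J c J<c sJ sc linked c<n = cycle 0 (suc c) (spoke∈F c sc) still-connected
    where
    still-connected : ∀ pre post → F ≡ pre ++ (0 , suc c) ∷ post → connected N (pre ++ post) 0 (suc c) ≡ true
    still-connected pre post F≡split with m≤n⇒∃[o]m+o≡n (<⇒≤ J<c)
    ... | d , refl = reach⇒connected N (pre ++ post) (1 + d) 0 (suc (J + d)) (s≤s (≤-trans (m≤n+m d J) (<⇒≤ c<n)))
          (reach-along-path (pre ++ post) 1 0 J d (λ i i<d → remains _ (linked⇒PathEdges J d linked i i<d) (λ ()))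
            (reach-along (pre ++ post) 0 0 0 (suc J) (remains _ (spoke∈F J sJ) (λ eq → <-irrefl (suc-injective (cong proj₂ eq)) J<c))
              (reach-refl (pre ++ post) 0)))
      where
      remains : ∀ e → e ∈ F → e ≢ (0 , suc (J + d)) → e ∈ pre ++ post
      remains e e∈ e≢ = ∈-split⁻ pre _ post e (subst (e ∈_) F≡split e∈) e≢

  segment-without-spoke : ∀ c₁ c → c₁ < c → Bits s false (suc c₁) (suc c) → nth p c₁ ≡ false → nth p c ≡ false → c < n → Failure
  segment-without-spoke c₁ c c₁<c none gapˡ gapʳ c<n =
    stranded (suc (suc c₁)) (≤-trans (s≤s c₁<c) c<n) (cut-off 0 (λ { (() , _) })) (cut-off 1 (λ { (s≤s () , _) }))
    where
    cut : CutBy (λ _ → ⊥) (suc (suc c₁)) (suc c)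
    cut = record
      { 1≤l = s≤s z≤n
      ; spoke = λ j l≤ ≤R sj → bit-conflict sj (none j (≤-pred l≤) ≤R)
      ; left = λ { j refl pj → bit-conflict pj gapˡ }
      ; right = λ { j refl pj → bit-conflict pj gapʳ } }
    cut-off : ∀ u → ¬ Between (suc (suc c₁)) (suc c) u → connected N F u (suc (suc c₁)) ≡ false
    cut-off u u∉ = closed⇒disconnected _ N F u _ (Closed-¬ _ F (Between-closed-F _ _ cut)) u∉ (λ w∉ → w∉ (≤-refl , s≤s c₁<c))

  reject-inZero⇒Failure : ∀ r c c₁ h → suc r + c ≡ n → InZero c₁ c h →
    run (shifted s c) (shifted p c) (suc r) (inZero h) ≡ false → Failure
  reject-inZero⇒Failure zero c c₁ h 1+c≡n inv rej = go h (nth s c) refl seen rej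
    where
    open InZero inv
    c<n : c < n
    c<n = remaining⇒< 0 c 1+c≡n
    go : ∀ h x → nth s c ≡ x → Seen h (suc c₁) c → final (inZero h) x ≡ false → Failure
    go true  true  sc sole _ = let open SoleSpoke sole in
      two-spokes-in-segment J c J<hi spokeJ sc (Bits-⊆ p true lo≤J ≤-refl linked) c<n
    go false false sc none _ =
      segment-without-spoke c₁ c c₁<c (Bits-snoc s false (suc c₁) c none sc) gap (lastPathBit c 1+c≡n) c<n
    go true  false _  _    ()
    go false true  _  _    ()
  reject-inZero⇒Failure (suc r) c c₁ h r+c≡n inv rej =
    go h (nth s c) (nth p c) refl refl seen (trans (sym (run-shift c r (inZero h))) rej)
    where
    open InZero inv
    c<n : c < n
    c<n = remaining⇒< (suc r) c r+c≡n
    continue : ∀ h′ → nth p c ≡ true → Seen h′ (suc c₁) (suc c) →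
      runMaybe (shifted s (suc c)) (shifted p (suc c)) (suc r) (just (inZero h′)) ≡ false → Failure
    continue h′ pc seen′ = reject-inZero⇒Failure r (suc c) c₁ h′ (remaining-step r c r+c≡n) (InZero-extend h′ inv pc seen′)
    restart : nth p c ≡ false → runMaybe (shifted s (suc c)) (shifted p (suc c)) (suc r) (just (inZero false)) ≡ false → Failure
    restart pc = reject-inZero⇒Failure r (suc c) c false (remaining-step r c r+c≡n) (InZero-start c pc)
    go : ∀ h x y → nth s c ≡ x → nth p c ≡ y → Seen h (suc c₁) c →
      runMaybe (shifted s (suc c)) (shifted p (suc c)) (suc r) (next (inZero h) x y) ≡ false → Failure
    go true  true  _     sc pc sole _ = let open SoleSpoke sole in
      two-spokes-in-segment J c J<hi spokeJ sc (Bits-⊆ p true lo≤J ≤-refl linked) c<n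
    go true  false true  sc pc sole = continue true pc (SoleSpoke-snoc (suc c₁) c sole sc)
    go true  false false sc pc sole = restart pc
    go false true  true  sc pc none = continue true pc (SoleSpoke-new (suc c₁) c c₁<c none sc)
    go false true  false sc pc none = restart pc
    go false false true  sc pc none = continue false pc (Bits-snoc s false (suc c₁) c none sc)
    go false false false sc pc none _ =
      segment-without-spoke c₁ c c₁<c (Bits-snoc s false (suc c₁) c none sc) gap pc c<n

  reject-inOne⇒Failure : ∀ r c d → suc r + c ≡ n → Bits s false 0 c → Bits p true 0 c → d ≡ k ∸ suc c →
    run (shifted s c) (shifted p c) (suc r) (inOne d) ≡ false → Failure
  reject-inOne⇒Failure zero c d 1+c≡n none linked d≡ rej = go d (nth s c) refl d≡ rej
    where
    go : ∀ d x → nth s c ≡ x → d ≡ k ∸ suc c → final (inOne d) x ≡ false → Failure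
    go d       true  sc _  _ = spoke-in-onePart c linked sc (remaining⇒< 0 c 1+c≡n)
    go (suc d) false _  d≡ _ = ⊥-elim (≤⇒≯ (subst (k ≤_) (sym 1+c≡n) k≤n) (m∸n≢0⇒n<m (λ k∸≡0 → 1+n≢0 (trans d≡ k∸≡0))))
    go zero    false _  _  ()
  reject-inOne⇒Failure (suc r) c d r+c≡n none linked d≡ rej =
    go d (nth s c) (nth p c) refl refl d≡ (trans (sym (run-shift c r (inOne d))) rej)
    where
    c<n : c < n
    c<n = remaining⇒< (suc r) c r+c≡n
    go : ∀ d x y → nth s c ≡ x → nth p c ≡ y → d ≡ k ∸ suc c →
      runMaybe (shifted s (suc c)) (shifted p (suc c)) (suc r) (next (inOne d) x y) ≡ false → Failure
    go d       true  _     sc _  _  _ = spoke-in-onePart c linked sc c<n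
    go d       false true  sc pc d≡   = reject-inOne⇒Failure r (suc c) (pred d) (remaining-step r c r+c≡n)
      (Bits-snoc s false 0 c none sc) (Bits-snoc p true 0 c linked pc) (trans (cong pred d≡) (pred[m∸n]≡m∸[1+n] k (suc c)))
    go (suc d) false false sc pc d≡ _ =
      onePart-too-short c (Bits-snoc s false 0 c none sc) pc (m∸n≢0⇒n<m (λ k∸≡0 → 1+n≢0 (trans d≡ k∸≡0)))
    go zero    false false sc pc _    = reject-inZero⇒Failure r (suc c) c false (remaining-step r c r+c≡n) (InZero-start c pc)

  disconnects : List Edge → Edge → Bool
  disconnects R e = not (connected N R (proj₁ e) (proj₂ e))

  acyclic≡allSplits : acyclic N F ≡ allSplits disconnects F
  acyclic≡allSplits = all-removeAt≡allSplits disconnects F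

  TwoForest⇒isTwoForest : TwoForest → isTwoForest N 1 k F ≡ true
  TwoForest⇒isTwoForest forest =
    ∧-true (trans acyclic≡allSplits (allSplits-true disconnects F separated))
      (∧-true (cong not 0≁1) (∧-true 1∼k (all-applyUpTo-true _ (λ i → i) N covered′)))
    where
    open TwoForest forest
    separated : ∀ pre e post → F ≡ pre ++ e ∷ post → disconnects (pre ++ post) e ≡ true
    separated pre (a , b) post F≡split =
      cong not (separating⇒disconnected a b (separating a b (subst ((a , b) ∈_) (sym F≡split) (∈-++⁺ʳ pre (here refl)))) pre post F≡split)
    covered′ : ∀ w → w < N → (connected N F 0 w ∨ connected N F 1 w) ≡ true
    covered′ zero    _ rewrite reach⇒connected N F 0 0 0 z≤n (reach-refl F 0) = refl
    covered′ (suc w) w<N with covered (suc w) (s≤s z≤n) (≤-pred w<N)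
    ... | inj₁ 0∼w rewrite 0∼w = refl
    ... | inj₂ 1∼w rewrite 1∼w = ∨-zeroʳ (connected N F 0 (suc w))

  Failure⇒¬isTwoForest : Failure → isTwoForest N 1 k F ≡ false
  Failure⇒¬isTwoForest (0∼1 conn) rewrite conn = ∧-zeroʳ (acyclic N F)
  Failure⇒¬isTwoForest (1≁k disc) rewrite disc | ∧-zeroʳ (not (connected N F 0 1)) = ∧-zeroʳ (acyclic N F)
  Failure⇒¬isTwoForest (cycle a b e∈ still-connected) with ∈-∃++ e∈
  ... | pre , post , F≡split
    rewrite trans acyclic≡allSplits (trans (cong (allSplits disconnects) F≡split)
                  (allSplits-false disconnects pre (a , b) post (cong not (still-connected pre post F≡split)))) = refl
  Failure⇒¬isTwoForest (stranded w w≤n 0≁w 1≁w)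
    rewrite all-false (λ w → connected N F 0 w ∨ connected N F 1 w) (upTo N) w (∈-upTo⁺ (s≤s w≤n)) (cong₂ _∨_ 0≁w 1≁w)
          | ∧-zeroʳ (connected N F 1 k) | ∧-zeroʳ (not (connected N F 0 1)) = ∧-zeroʳ (acyclic N F)

  run-from-start : ∀ r q → run (shifted s 0) (shifted p 0) (suc r) q ≡ run (nth s) (nth p) (suc r) q
  run-from-start r q = run-cong (suc r) q (λ i → cong (nth s) (+-identityʳ i)) (λ i → cong (nth p) (+-identityʳ i))

  isTwoForest≡run : ∀ r → suc r + 0 ≡ n → isTwoForest N 1 k F ≡ run (nth s) (nth p) (suc r) (inOne (k ∸ 1))
  isTwoForest≡run r r+1≡n with run (nth s) (nth p) (suc r) (inOne (k ∸ 1)) in result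
  ... | true  = TwoForest⇒isTwoForest (accept-inOne⇒TwoForest r 0 (k ∸ 1) r+1≡n
                  (Bits-empty s false 0) (Bits-empty p true 0) refl (trans (run-from-start r _) result))
  ... | false = Failure⇒¬isTwoForest (reject-inOne⇒Failure r 0 (k ∸ 1) r+1≡n
                  (Bits-empty s false 0) (Bits-empty p true 0) refl (trans (run-from-start r _) result))

countTrue : ∀ {A : Set} → (A → Bool) → List A → ℕ
countTrue Q xs = length (filter (λ x → Q x ≟B true) xs)

countTrue-++ : ∀ {A : Set} (Q : A → Bool) xs ys → countTrue Q (xs ++ ys) ≡ countTrue Q xs + countTrue Q ys
countTrue-++ Q []       ys = refl
countTrue-++ Q (x ∷ xs) ys with Q x
... | true  = cong suc (countTrue-++ Q xs ys)
... | false = countTrue-++ Q xs ys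

countTrue-map : ∀ {A B : Set} (Q : B → Bool) (f : A → B) xs → countTrue Q (map f xs) ≡ countTrue (Q ∘ f) xs
countTrue-map Q f []       = refl
countTrue-map Q f (x ∷ xs) with Q (f x)
... | true  = cong suc (countTrue-map Q f xs)
... | false = countTrue-map Q f xs

countTrue-singleton : ∀ {A : Set} (Q : A → Bool) x → countTrue Q (x ∷ []) ≡ (if Q x then 1 else 0)
countTrue-singleton Q x with Q x
... | true  = refl
... | false = refl

countSubsets : ℕ → (List Bool → Bool) → ℕ
countSubsets m Q = countTrue Q (subsets m)

countSubsets-suc : ∀ m Q → countSubsets (suc m) Q ≡ countSubsets m (Q ∘ (true ∷_)) + countSubsets m (Q ∘ (false ∷_))
countSubsets-suc m Q = trans (countTrue-++ Q (map (true ∷_) (subsets m)) (map (false ∷_) (subsets m)))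
  (cong₂ _+_ (countTrue-map Q (true ∷_) (subsets m)) (countTrue-map Q (false ∷_) (subsets m)))

countSubsets-cong : ∀ m Q Q′ → (∀ b → length b ≡ m → Q b ≡ Q′ b) → countSubsets m Q ≡ countSubsets m Q′
countSubsets-cong zero    Q Q′ Q≗ = begin
  countTrue Q ([] ∷ [])      ≡⟨ countTrue-singleton Q [] ⟩
  (if Q [] then 1 else 0)    ≡⟨ cong (if_then 1 else 0) (Q≗ [] refl) ⟩
  (if Q′ [] then 1 else 0)   ≡⟨ countTrue-singleton Q′ [] ⟨
  countTrue Q′ ([] ∷ [])     ∎
  where open ≡-Reasoning
countSubsets-cong (suc m) Q Q′ Q≗ = trans (countSubsets-suc m Q) (trans
  (cong₂ _+_ (countSubsets-cong m _ _ (λ b |b| → Q≗ (true ∷ b) (cong suc |b|)))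
             (countSubsets-cong m _ _ (λ b |b| → Q≗ (false ∷ b) (cong suc |b|))))
  (sym (countSubsets-suc m Q′)))

countSubsets-false : ∀ m → countSubsets m (λ _ → false) ≡ 0
countSubsets-false zero    = refl
countSubsets-false (suc m) = trans (countSubsets-suc m _) (cong₂ _+_ (countSubsets-false m) (countSubsets-false m))

countPairs : ℕ → ℕ → (List Bool → List Bool → Bool) → ℕ
countPairs zero    b Q = countSubsets b (Q [])
countPairs (suc a) b Q = countPairs a b (Q ∘ (true ∷_)) + countPairs a b (Q ∘ (false ∷_))

countSubsets-+ : ∀ a b Q → countSubsets (a + b) Q ≡ countPairs a b (λ s p → Q (s ++ p))
countSubsets-+ zero    b Q = refl
countSubsets-+ (suc a) b Q = trans (countSubsets-suc (a + b) Q) (cong₂ _+_ (countSubsets-+ a b _) (countSubsets-+ a b _))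

countPairs-cong : ∀ a b Q Q′ → (∀ s p → length s ≡ a → length p ≡ b → Q s p ≡ Q′ s p) → countPairs a b Q ≡ countPairs a b Q′
countPairs-cong zero    b Q Q′ Q≗ = countSubsets-cong b _ _ (λ p |p| → Q≗ [] p refl |p|)
countPairs-cong (suc a) b Q Q′ Q≗ =
  cong₂ _+_ (countPairs-cong a b _ _ (λ s p |s| |p| → Q≗ (true ∷ s) p (cong suc |s|) |p|))
            (countPairs-cong a b _ _ (λ s p |s| |p| → Q≗ (false ∷ s) p (cong suc |s|) |p|))

countPairs-false : ∀ a b → countPairs a b (λ _ _ → false) ≡ 0
countPairs-false zero    b = countSubsets-false b
countPairs-false (suc a) b = cong₂ _+_ (countPairs-false a b) (countPairs-false a b)

countPairs-sucʳ : ∀ a b Q → countPairs a (suc b) Q ≡ countPairs a b (λ s p → Q s (true ∷ p)) + countPairs a b (λ s p → Q s (false ∷ p))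
countPairs-sucʳ zero    b Q = countSubsets-suc b (Q [])
countPairs-sucʳ (suc a) b Q = trans
  (cong₂ _+_ (countPairs-sucʳ a b (Q ∘ (true ∷_))) (countPairs-sucʳ a b (Q ∘ (false ∷_))))
  (interchange +-commutativeSemigroup (countPairs a b (λ s p → Q (true ∷ s) (true ∷ p))) (countPairs a b (λ s p → Q (true ∷ s) (false ∷ p)))
               (countPairs a b (λ s p → Q (false ∷ s) (true ∷ p))) (countPairs a b (λ s p → Q (false ∷ s) (false ∷ p))))

accepted : ℕ → State → ℕ
accepted r q = countPairs (suc r) r (λ s p → run (nth s) (nth p) (suc r) q)

acceptedMaybe : ℕ → Maybe State → ℕ
acceptedMaybe r m = countPairs (suc r) r (λ s p → runMaybe (nth s) (nth p) (suc r) m)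

acceptedMaybe-nothing : ∀ r → acceptedMaybe r nothing ≡ 0
acceptedMaybe-nothing r = countPairs-false (suc r) r

accepted-suc : ∀ r q → accepted (suc r) q ≡ (acceptedMaybe r (next q true true)  + acceptedMaybe r (next q true false))
                                           + (acceptedMaybe r (next q false true) + acceptedMaybe r (next q false false))
accepted-suc r q = cong₂ _+_ (countPairs-sucʳ (suc r) r (λ s p → run (nth (true ∷ s)) (nth p) (suc (suc r)) q))
                             (countPairs-sucʳ (suc r) r (λ s p → run (nth (false ∷ s)) (nth p) (suc (suc r)) q))

-- a r = accepted r (inZero false) and b r = accepted r (inZero true) satisfy
-- a (r + 1) = b r + a r + a r and b (r + 1) = b r + a r.
accepted-inZero : ∀ r → accepted r (inZero false) ≡ fib (suc (suc (r + r))) × accepted r (inZero true) ≡ fib (suc (r + r))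
accepted-inZero zero    = refl , refl
accepted-inZero (suc r) with accepted-inZero r
... | IHfalse , IHtrue = without , with′
  where
  without : accepted (suc r) (inZero false) ≡ fib (suc (suc (suc r + suc r)))
  without rewrite accepted-suc r (inZero false) | acceptedMaybe-nothing r | IHfalse | IHtrue | +-suc r r
                | +-identityʳ (fib (suc (suc (r + r)))) =
    +-comm (fib (suc (r + r)) + fib (suc (suc (r + r)))) (fib (suc (suc (r + r))))
  with′ : accepted (suc r) (inZero true) ≡ fib (suc (suc r + suc r))
  with′ rewrite accepted-suc r (inZero true) | acceptedMaybe-nothing r | IHfalse | IHtrue | +-suc r r = refl

accepted-inOne-zero : ∀ r → accepted r (inOne 0) ≡ fib (suc (r + r))
accepted-inOne-zero zero    = refl
accepted-inOne-zero (suc r)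
  rewrite accepted-suc r (inOne 0) | acceptedMaybe-nothing r | accepted-inOne-zero r | proj₁ (accepted-inZero r) | +-suc r r = refl

accepted-inOne : ∀ r d → d ≤ r → accepted r (inOne d) ≡ accepted (r ∸ d) (inOne 0)
accepted-inOne r       zero    _         = refl
accepted-inOne (suc r) (suc d) (s≤s d≤r) rewrite accepted-suc r (inOne (suc d)) | acceptedMaybe-nothing r =
  trans (+-identityʳ _) (accepted-inOne r d d≤r)

2[m∸n]+1 : ∀ m n → suc ((m ∸ n) + (m ∸ n)) ≡ 2 * suc m ∸ 2 * suc n + 1
2[m∸n]+1 m n = begin
  suc ((m ∸ n) + (m ∸ n))      ≡⟨ cong (λ x → suc ((m ∸ n) + x)) (sym (+-identityʳ (m ∸ n))) ⟩
  1 + 2 * (m ∸ n)              ≡⟨ +-comm 1 (2 * (m ∸ n)) ⟩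
  2 * (suc m ∸ suc n) + 1      ≡⟨ cong (_+ 1) (*-distribˡ-∸ 2 (suc m) (suc n)) ⟩
  2 * suc m ∸ 2 * suc n + 1    ∎
  where open ≡-Reasoning

lemma4p1 : (n k : ℕ) → 1 ≤ n → 1 ≤ k → k ≤ n →
           kappaFan n 1 k ≡ fib (2 * n ∸ 2 * k + 1)
lemma4p1 (suc r) (suc d) _ 1≤k (s≤s d≤r) = begin
  countSubsets (length (fanEdges (suc r))) isFanTwoForest  ≡⟨ cong (λ m → countSubsets m isFanTwoForest) (length-fanEdges (suc r)) ⟩
  countSubsets (suc r + r) isFanTwoForest                  ≡⟨ countSubsets-+ (suc r) r isFanTwoForest ⟩
  countPairs (suc r) r (λ s p → isFanTwoForest (s ++ p))   ≡⟨ countPairs-cong (suc r) r _ _ isTwoForest≡run ⟩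
  accepted r (inOne d)                                     ≡⟨ accepted-inOne r d d≤r ⟩
  accepted (r ∸ d) (inOne 0)                               ≡⟨ accepted-inOne-zero (r ∸ d) ⟩
  fib (suc ((r ∸ d) + (r ∸ d)))                            ≡⟨ cong fib (2[m∸n]+1 r d) ⟩
  fib (2 * suc r ∸ 2 * suc d + 1)                          ∎
  where
  open ≡-Reasoning
  isFanTwoForest : List Bool → Bool
  isFanTwoForest b = isTwoForest (suc (suc r)) 1 (suc d) (select (fanEdges (suc r)) b)
  isTwoForest≡run : ∀ s p → length s ≡ suc r → length p ≡ r →
    isFanTwoForest (s ++ p) ≡ run (nth s) (nth p) (suc r) (inOne d)
  isTwoForest≡run s p |s| |p| = FanSelection.isTwoForest≡run (suc r) s p |s| |p| (suc d) 1≤k (s≤s d≤r) r (+-identityʳ (suc r))
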